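{- Let $\mathcal{A}$ be a finite structure over a vocabulary containing, for each binary relation symbol $f$ in a set $F$, a companion binary relation symbol $f^*$. Suppose $\mathcal{A}$ satisfies $T_1[f]$ for every $f\in F$ and every instance of the induction principle $\mathrm{Ind}[Z,P,f]$ for $f\in F$. Then $\mathcal{A}$ is a TC model, i.e., $(f^*)^{\mathcal{A}}$ is the reflexive transitive closure of $f^{\mathcal{A}}$ for every $f\in F$.
   Context: $T_1[f]\equiv \forall u,v\,.\, f^*(u,v)\leftrightarrow \big((u=v)\lor \exists w\,.\, f(u,w)\land f^*(w,v)\big)$. For first-order formulas $Z(u),P(u)$ (which may contain further free variables, over which the instance is universally closed) the induction principle is $\mathrm{Ind}[Z,P,f]\equiv \big[(\forall w\,.\,Z(w)\rightarrow P(w))\land(\forall u,v\,.\,P(u)\land f(u,v)\rightarrow P(v))\big]\rightarrow \forall u,w\,.\,Z(w)\land f^*(w,u)\rightarrow P(u)$. -}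

module Defs where

open import Data.Nat using (ℕ; zero; suc)
open import Data.Fin using (Fin; zero; suc)
open import Data.Bool using (Bool; T)
open import Data.Product using (Σ; _×_; _,_)
open import Data.Sum using (_⊎_)
open import Data.Empty using (⊥)
open import Data.Unit using (⊤)
open import Relation.Binary.PropositionalEquality using (_≡_)
open import Relation.Binary.Construct.Closure.ReflexiveTransitive using (Star)
open import Function.Bundles using (_⇔_)

record Vocabulary : Set₁ where
  field
    Sym : ℕ → Set

open Vocabulary public

-- Finite structures: universe Fin n (any finite set up to bijection),
-- each k-ary symbol interpreted as a (decidable, Bool-valued) k-ary relation.

record Structure (V : Vocabulary) : Set where
  field
    size : ℕ
    rel  : ∀ {k} → Sym V k → (Fin k → Fin size) → Bool

open Structure public

Carrier : ∀ {V} → Structure V → Set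
Carrier 𝒜 = Fin (size 𝒜)

-- First-order formulas (with equality) over V, with de Bruijn variables:
-- Formula V m = formulas with free variables among Fin m.

data Formula (V : Vocabulary) : ℕ → Set where
  ⊤'   : ∀ {m} → Formula V m
  ⊥'   : ∀ {m} → Formula V m
  _≐_  : ∀ {m} → Fin m → Fin m → Formula V m
  atom : ∀ {m k} → Sym V k → (Fin k → Fin m) → Formula V m
  ¬'_  : ∀ {m} → Formula V m → Formula V m
  _∧'_ : ∀ {m} → Formula V m → Formula V m → Formula V m
  _∨'_ : ∀ {m} → Formula V m → Formula V m → Formula V m
  _⇒'_ : ∀ {m} → Formula V m → Formula V m → Formula V m
  ∀'_  : ∀ {m} → Formula V (suc m) → Formula V m
  ∃'_  : ∀ {m} → Formula V (suc m) → Formula V m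

_∷ₐ_ : ∀ {A : Set} {m} → A → (Fin m → A) → Fin (suc m) → A
(a ∷ₐ ρ) zero    = a
(a ∷ₐ ρ) (suc i) = ρ i

_⊨_[_] : ∀ {V m} (𝒜 : Structure V) → Formula V m → (Fin m → Carrier 𝒜) → Set
𝒜 ⊨ ⊤' [ ρ ] = ⊤
𝒜 ⊨ ⊥' [ ρ ] = ⊥
𝒜 ⊨ (i ≐ j) [ ρ ] = ρ i ≡ ρ j
𝒜 ⊨ atom R ts [ ρ ] = T (rel 𝒜 R (λ i → ρ (ts i)))
𝒜 ⊨ (¬' φ) [ ρ ] = 𝒜 ⊨ φ [ ρ ] → ⊥
𝒜 ⊨ (φ ∧' ψ) [ ρ ] = 𝒜 ⊨ φ [ ρ ] × 𝒜 ⊨ ψ [ ρ ]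
𝒜 ⊨ (φ ∨' ψ) [ ρ ] = 𝒜 ⊨ φ [ ρ ] ⊎ 𝒜 ⊨ ψ [ ρ ]
𝒜 ⊨ (φ ⇒' ψ) [ ρ ] = 𝒜 ⊨ φ [ ρ ] → 𝒜 ⊨ ψ [ ρ ]
𝒜 ⊨ (∀' φ) [ ρ ] = ∀ a → 𝒜 ⊨ φ [ a ∷ₐ ρ ]
𝒜 ⊨ (∃' φ) [ ρ ] = Σ (Carrier 𝒜) λ a → 𝒜 ⊨ φ [ a ∷ₐ ρ ]

Rel₂ : ∀ {V} (𝒜 : Structure V) → Sym V 2 → Carrier 𝒜 → Carrier 𝒜 → Set
Rel₂ 𝒜 R a b = T (rel 𝒜 R (a ∷ₐ (b ∷ₐ λ ())))

SatT₁ : ∀ {V} (𝒜 : Structure V) (f f* : Sym V 2) → Set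
SatT₁ 𝒜 f f* = ∀ u v →
  Rel₂ 𝒜 f* u v ⇔ (u ≡ v ⊎ Σ (Carrier 𝒜) λ w → Rel₂ 𝒜 f u w × Rel₂ 𝒜 f* w v)

-- 𝒜 ⊨ Ind[Z,P,f] (universal closure over the parameters ρ).
-- Z, P : Formula V (suc m): variable 0 is the distinguished variable u,
-- variables 1..m are the additional free variables (parameters).
SatInd : ∀ {V m} (𝒜 : Structure V) (f f* : Sym V 2)
         (Z P : Formula V (suc m)) → Set
SatInd {V} {m} 𝒜 f f* Z P = (ρ : Fin m → Carrier 𝒜) →
  ((∀ w → 𝒜 ⊨ Z [ w ∷ₐ ρ ] → 𝒜 ⊨ P [ w ∷ₐ ρ ]) ×
   (∀ u v → 𝒜 ⊨ P [ u ∷ₐ ρ ] × Rel₂ 𝒜 f u v → 𝒜 ⊨ P [ v ∷ₐ ρ ])) →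
  ∀ u w → 𝒜 ⊨ Z [ w ∷ₐ ρ ] × Rel₂ 𝒜 f* w u → 𝒜 ⊨ P [ u ∷ₐ ρ ]

IsTCModel : ∀ {V} (𝒜 : Structure V) {F : Set} (f f* : F → Sym V 2) → Set
IsTCModel 𝒜 f f* = ∀ i u v → Rel₂ 𝒜 (f* i) u v ⇔ Star (Rel₂ 𝒜 (f i)) u v

-- Every path in f yields f* by the right-to-left half of T₁, since f* is reflexive and
-- closed under prefixing an f-step.  The converse uses only induction: in a finite
-- structure every subset is first-order definable once each element is named by a
-- parameter, so Ind[P,P,f] shows that every f-closed subset is also f*-closed.  Applied
-- to the set of elements reachable from u, which is computable as a finite fixed point,
-- this puts every f*-successor of u on an f-path from u.
module Submission where

open import Defs
open import Data.Nat using (ℕ; suc; zero; _≤_; z≤n)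
open import Data.Nat.Properties using (≤-trans; ≤-<-trans; 1+n≰n)
open import Data.Nat.GeneralisedArithmetic using (fold)
open import Data.Fin using (Fin; zero; suc)
open import Data.Fin.Properties using (any?)
open import Data.Fin.Subset using (Subset; _∈_; _⊆_; _⊂_; ⁅_⁆; ∣_∣; inside; outside)
open import Data.Fin.Subset.Properties
  using (_∈?_; _⊂?_; ⊆-antisym; p⊂q⇒∣p∣<∣q∣; ∣p∣≤n; x∈⁅x⁆; x∈⁅y⁆⇒x≡y)
open import Data.Vec using (_∷_; []; tabulate)
open import Data.Vec.Base using (here; there)
open import Data.Vec.Properties using (lookup∘tabulate; []=⇒lookup; lookup⇒[]=)
open import Data.Bool using (T?)
open import Data.Product using (∃; _×_; _,_)
open import Data.Sum using (_⊎_; inj₁; inj₂)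
open import Function using (id; _∘_)
open import Function.Bundles using (_⇔_; mk⇔; Equivalence)
open import Level using (0ℓ)
open import Relation.Nullary using (¬_; yes; no; does; contradiction)
open import Relation.Nullary.Decidable using (_×-dec_; _⊎-dec_; dec-true)
open import Relation.Unary using (Pred)
import Relation.Unary as U
open import Relation.Binary using (Rel; Decidable)
open import Relation.Binary.PropositionalEquality using (_≡_; refl; sym; trans; cong; subst)
open import Relation.Binary.Construct.Closure.ReflexiveTransitive using (Star; ε; _◅_; _◅◅_)

module _ {n : ℕ} where

  ∈-tabulate-does : {P : Pred (Fin n) 0ℓ} (P? : U.Decidable P) (x : Fin n) →
                    x ∈ tabulate (does ∘ P?) ⇔ P x
  ∈-tabulate-does {P} P? x = mk⇔ sound complete
    where
    sound : x ∈ tabulate (does ∘ P?) → P x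
    sound x∈ with P? x | trans (sym (lookup∘tabulate (does ∘ P?) x)) ([]=⇒lookup x∈)
    ... | yes px | _ = px
    ... | no _   | ()
    complete : P x → x ∈ tabulate (does ∘ P?)
    complete px = lookup⇒[]= x _ (trans (lookup∘tabulate (does ∘ P?) x) (dec-true (P? x) px))

  ⊆∧⊄⇒≡ : {p q : Subset n} → p ⊆ q → ¬ (p ⊂ q) → p ≡ q
  ⊆∧⊄⇒≡ {p} {q} p⊆q p⊄q = ⊆-antisym p⊆q q⊆p
    where
    q⊆p : q ⊆ p
    q⊆p {x} x∈q with x ∈? p
    ... | yes x∈p = x∈p
    ... | no x∉p = contradiction ((λ {y} → p⊆q {y}) , x , x∈q , x∉p) p⊄q

-- Until the iteration becomes stationary each step adds an element, so it is
-- stationary after n + 1 steps.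
module _ {n : ℕ} (g : Subset n → Subset n) (inflationary : ∀ p → p ⊆ g p) where

  fold-⊇ : ∀ p k → p ⊆ fold p g k
  fold-⊇ p zero    = id
  fold-⊇ p (suc k) = inflationary (fold p g k) ∘ fold-⊇ p k

  fold-fixed-or-large : ∀ p k → g (fold p g k) ≡ fold p g k ⊎ k ≤ ∣ fold p g k ∣
  fold-fixed-or-large p zero = inj₂ z≤n
  fold-fixed-or-large p (suc k) with fold-fixed-or-large p k | fold p g k ⊂? g (fold p g k)
  ... | inj₁ fixed | _      = inj₁ (cong g fixed)
  ... | inj₂ k≤∣q∣ | yes q⊂gq = inj₂ (≤-<-trans k≤∣q∣ (p⊂q⇒∣p∣<∣q∣ q⊂gq))
  ... | inj₂ _     | no q⊄gq =
    inj₁ (cong g (sym (⊆∧⊄⇒≡ (inflationary (fold p g k)) q⊄gq)))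

  fold-fixed : ∀ p → g (fold p g (suc n)) ≡ fold p g (suc n)
  fold-fixed p with fold-fixed-or-large p (suc n)
  ... | inj₁ fixed = fixed
  ... | inj₂ large = contradiction (≤-trans large (∣p∣≤n (fold p g (suc n)))) 1+n≰n

module Reachability {n : ℕ} {R : Rel (Fin n) 0ℓ} (R? : Decidable R) where

  OneStep : Subset n → Pred (Fin n) 0ℓ
  OneStep S y = y ∈ S ⊎ ∃ λ x → x ∈ S × R x y

  oneStep? : ∀ S → U.Decidable (OneStep S)
  oneStep? S y = (y ∈? S) ⊎-dec any? (λ x → (x ∈? S) ×-dec R? x y)

  post : Subset n → Subset n
  post S = tabulate (does ∘ oneStep? S)

  ∈-post : ∀ S y → y ∈ post S ⇔ OneStep S y
  ∈-post S y = ∈-tabulate-does (oneStep? S) y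

  post-inflationary : ∀ S → S ⊆ post S
  post-inflationary S {y} y∈S = Equivalence.from (∈-post S y) (inj₁ y∈S)

  reach : Fin n → Subset n
  reach u = fold ⁅ u ⁆ post (suc n)

  u∈reach : ∀ u → u ∈ reach u
  u∈reach u = fold-⊇ post post-inflationary ⁅ u ⁆ (suc n) (x∈⁅x⁆ u)

  reach-closed : ∀ {u x y} → x ∈ reach u → R x y → y ∈ reach u
  reach-closed {u} {x} {y} x∈ r = subst (y ∈_) (fold-fixed post post-inflationary ⁅ u ⁆)
    (Equivalence.from (∈-post (reach u) y) (inj₂ (x , x∈ , r)))

  reach-sound : ∀ {u x} → x ∈ reach u → Star R u x
  reach-sound {u} = fold-sound (suc n)
    where
    fold-sound : ∀ k {x} → x ∈ fold ⁅ u ⁆ post k → Star R u x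
    fold-sound zero x∈ with x∈⁅y⁆⇒x≡y u x∈
    ... | refl = ε
    fold-sound (suc k) {x} x∈ with Equivalence.to (∈-post _ x) x∈
    ... | inj₁ x∈′           = fold-sound k x∈′
    ... | inj₂ (y , y∈ , r) = fold-sound k y∈ ◅◅ (r ◅ ε)

module Definability {V : Vocabulary} (𝒜 : Structure V) where

  -- With ι naming the elements of Fin k by parameters, oneOf S ι defines S.
  oneOf : ∀ {k m} → Subset k → (Fin k → Fin m) → Formula V (suc m)
  oneOf []            ι = ⊥'
  oneOf (inside ∷ S)  ι = (zero ≐ suc (ι zero)) ∨' oneOf S (ι ∘ suc)
  oneOf (outside ∷ S) ι = oneOf S (ι ∘ suc)

  oneOf-sound : ∀ {k m} (S : Subset k) (ι : Fin k → Fin m) (ρ : Fin m → Carrier 𝒜) {x} →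
                𝒜 ⊨ oneOf S ι [ x ∷ₐ ρ ] → ∃ λ a → a ∈ S × x ≡ ρ (ι a)
  oneOf-sound []            ι ρ ()
  oneOf-sound (inside ∷ S)  ι ρ (inj₁ x≡) = zero , here , x≡
  oneOf-sound (inside ∷ S)  ι ρ (inj₂ ⊨S) with oneOf-sound S (ι ∘ suc) ρ ⊨S
  ... | a , a∈ , x≡ = suc a , there a∈ , x≡
  oneOf-sound (outside ∷ S) ι ρ ⊨S with oneOf-sound S (ι ∘ suc) ρ ⊨S
  ... | a , a∈ , x≡ = suc a , there a∈ , x≡

  oneOf-complete : ∀ {k m} (S : Subset k) (ι : Fin k → Fin m) (ρ : Fin m → Carrier 𝒜) {a} →
                   a ∈ S → 𝒜 ⊨ oneOf S ι [ ρ (ι a) ∷ₐ ρ ]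
  oneOf-complete (inside ∷ S)  ι ρ here       = inj₁ refl
  oneOf-complete (inside ∷ S)  ι ρ (there a∈) = inj₂ (oneOf-complete S (ι ∘ suc) ρ a∈)
  oneOf-complete (outside ∷ S) ι ρ (there a∈) = oneOf-complete S (ι ∘ suc) ρ a∈

  ⊨oneOf⇔∈ : (S : Subset (size 𝒜)) (x : Carrier 𝒜) → 𝒜 ⊨ oneOf S id [ x ∷ₐ id ] ⇔ x ∈ S
  ⊨oneOf⇔∈ S x = mk⇔ member (oneOf-complete S id id)
    where
    member : 𝒜 ⊨ oneOf S id [ x ∷ₐ id ] → x ∈ S
    member ⊨S with oneOf-sound S id id ⊨S
    ... | a , a∈ , refl = a∈

module _ {V : Vocabulary} (𝒜 : Structure V) (f f* : Sym V 2) where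

  open Definability 𝒜

  Star⇒f* : SatT₁ 𝒜 f f* → ∀ {u v} → Star (Rel₂ 𝒜 f) u v → Rel₂ 𝒜 f* u v
  Star⇒f* t₁ {u} ε = Equivalence.from (t₁ u u) (inj₁ refl)
  Star⇒f* t₁ {u} {v} (_◅_ {j = w} r path) =
    Equivalence.from (t₁ u v) (inj₂ (w , r , Star⇒f* t₁ path))

  f*-preserves-f-closed : (∀ m (Z P : Formula V (suc m)) → SatInd 𝒜 f f* Z P) →
                          (S : Subset (size 𝒜)) → (∀ {x y} → x ∈ S → Rel₂ 𝒜 f x y → y ∈ S) →
                          ∀ {u v} → u ∈ S → Rel₂ 𝒜 f* u v → v ∈ S
  f*-preserves-f-closed ind S closed {u} {v} u∈S f*uv =
    to (⊨oneOf⇔∈ S v)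
       (ind (size 𝒜) P P id ((λ _ → id) , step) v u (from (⊨oneOf⇔∈ S u) u∈S , f*uv))
    where
    open Equivalence
    P : Formula V (suc (size 𝒜))
    P = oneOf S id
    step : ∀ x y → 𝒜 ⊨ P [ x ∷ₐ id ] × Rel₂ 𝒜 f x y → 𝒜 ⊨ P [ y ∷ₐ id ]
    step x y (⊨Px , r) = from (⊨oneOf⇔∈ S y) (closed (to (⊨oneOf⇔∈ S x) ⊨Px) r)

  f*⇒Star : (∀ m (Z P : Formula V (suc m)) → SatInd 𝒜 f f* Z P) →
            ∀ {u v} → Rel₂ 𝒜 f* u v → Star (Rel₂ 𝒜 f) u v
  f*⇒Star ind {u} = reach-sound ∘ f*-preserves-f-closed ind (reach u) reach-closed (u∈reach u)
    where open Reachability {R = Rel₂ 𝒜 f} (λ x y → T? _)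

proposition4p3 : (V : Vocabulary) (𝒜 : Structure V)
    (F : Set) (f f* : F → Sym V 2) →
    (∀ i → SatT₁ 𝒜 (f i) (f* i)) →
    (∀ i (m : ℕ) (Z P : Formula V (suc m)) → SatInd 𝒜 (f i) (f* i) Z P) →
    IsTCModel 𝒜 f f*
proposition4p3 V 𝒜 F f f* t₁ ind i u v =
  mk⇔ (f*⇒Star 𝒜 (f i) (f* i) (ind i)) (Star⇒f* 𝒜 (f i) (f* i) (t₁ i))
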